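{- Let $K$ be a finite field of characteristic at least $5$, $V$ a symplectic $K$-vector space and $G\subseteq\mathrm{GSp}(V)$ a subgroup. Let $V = S_1 \oplus \dots \oplus S_h$ be a decomposition of $V$ into linearly independent, mutually orthogonal $K$-subspaces such that $\mathcal{L}(G) \subseteq S_1 \cup \dots \cup S_h$. (a) If $v_1,v_2 \in \mathcal{L}(G) \cap S_1$ are such that $v_1+v_2 \in \mathcal{L}(G)$, then for every $g \in G$ there exists an index $i \in \{1,\dots,h\}$ such that $g(v_1)$ and $g(v_2)$ both belong to $S_i$. (b) If $L\subseteq K$ is a subfield and $S_1$ is $(L,G)$-rationalisable, then for every $g \in G$ there exists an index $i \in \{1,\dots,h\}$ such that $gS_1 \subseteq S_i$.
   Context: $V$ is a finite-dimensional $K$-vector space with a nondegenerate alternating form $v\bullet w$. $\mathrm{GSp}(V)$ is the group of $A\in\mathrm{GL}(V)$ with $(Av)\bullet(Aw)=\alpha(v\bullet w)$ for some $\alpha\in K^\times$ and all $v,w$. For $v\in V,\lambda\in K$, $T_v[\lambda](u)=u+\lambda(u\bullet v)v$; nontrivial symplectic transvections are the $T_v[\lambda]$ with $v\ne0,\lambda\ne0$, with centre $\langle v\rangle_K$. $\mathcal{L}(G)$ is the set of nonzero $v\in V$ with $T_v[\lambda]\in G$ for some $\lambda\in K^\times$. For an $L$-subspace $W_L\subseteq V$, $W_K$ is its $K$-span. $W_L$ is $L$-rational if $\dim_K W_K=\dim_L W_L$ and $v\bullet w\in L$ for all $v,w\in W_L$; it is $(L,G)$-rational if it is $L$-rational,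 $T_v[\lambda]\in G$ for all $v\in W_L,\lambda\in L$, and every nontrivial symplectic transvection in $G$ with centre contained in $W_K$ equals $T_v[\lambda]$ for some $0\ne v\in W_L$, $\lambda\in L^\times$. A $K$-subspace $W$ is $(L,G)$-rationalisable if $W=W_K$ for some $(L,G)$-rational $W_L$. -}

module Defs where

open import Level using (Level; _⊔_)
open import Algebra.Bundles using (CommutativeRing)
open import Data.Nat using (ℕ; zero; suc; _≤_; _<_)
open import Data.Fin using (Fin; zero; suc; _≟_)
open import Data.List using (List; []; _∷_)
open import Data.List.Membership.Setoid using ()
open import Data.Product using (Σ; ∃; _×_; _,_)
open import Data.Sum using (_⊎_)
import Data.Unit
open import Relation.Nullary using (¬_)
open import Relation.Binary.PropositionalEquality using (_≡_)

record Field (c ℓ : Level) : Set (Level.suc (c ⊔ ℓ)) where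
  field
    commutativeRing : CommutativeRing c ℓ
  open CommutativeRing commutativeRing public
    using (Carrier; _≈_; _+_; _*_; -_; 0#; 1#; isCommutativeRing)
  field
    1≉0     : ¬ (1# ≈ 0#)
    inverse : ∀ x → ¬ (x ≈ 0#) → ∃ λ y → (x * y) ≈ 1#

module FieldTheory {c ℓ : Level} (K : Field c ℓ) where
  open Field K using (Carrier; _≈_; _+_; _*_; -_; 0#; 1#)

  ℓK : Level
  ℓK = c ⊔ ℓ

  data _∈L_ (x : Carrier) : List Carrier → Set (c ⊔ ℓ) where
    here  : ∀ {y ys} → x ≈ y → x ∈L (y ∷ ys)
    there : ∀ {y ys} → x ∈L ys → x ∈L (y ∷ ys)

  IsFinite : Set (c ⊔ ℓ)
  IsFinite = ∃ λ (xs : List Carrier) → ∀ x → x ∈L xs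

  _·1 : ℕ → Carrier
  zero  ·1 = 0#
  suc n ·1 = 1# + (n ·1)

  -- characteristic at least 5: n · 1 ≠ 0 for 1 ≤ n < 5
  -- (a finite field has positive characteristic = least n ≥ 1 with n·1 = 0)
  CharAtLeast5 : Set ℓ
  CharAtLeast5 = ∀ n → 1 ≤ n → n < 5 → ¬ ((n ·1) ≈ 0#)

  -- V = K^n (coordinates), sums over Fin n

  Σ[_] : ∀ {n} → (Fin n → Carrier) → Carrier
  Σ[_] {zero}  f = 0#
  Σ[_] {suc n} f = f zero + Σ[_] (λ i → f (suc i))

  Vec : ℕ → Set c
  Vec n = Fin n → Carrier

  _≈ᵥ_ : ∀ {n} → Vec n → Vec n → Set ℓ
  u ≈ᵥ v = ∀ i → u i ≈ v i

  0ᵥ : ∀ {n} → Vec n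
  0ᵥ i = 0#

  _+ᵥ_ : ∀ {n} → Vec n → Vec n → Vec n
  (u +ᵥ v) i = u i + v i

  _·ᵥ_ : ∀ {n} → Carrier → Vec n → Vec n
  (a ·ᵥ v) i = a * v i

  Σᵥ : ∀ {n m} → (Fin m → Vec n) → Vec n
  Σᵥ f i = Σ[ (λ k → f k i) ]

  Nonzero : ∀ {n} → Vec n → Set ℓ
  Nonzero v = ¬ (v ≈ᵥ 0ᵥ)

  -- matrices = linear endomorphisms of K^n
  Mat : ℕ → Set c
  Mat n = Fin n → Fin n → Carrier

  _≈ₘ_ : ∀ {n} → Mat n → Mat n → Set ℓ
  A ≈ₘ B = ∀ i j → A i j ≈ B i j

  δ : ∀ {n} → Fin n → Fin n → Carrier
  δ i j with i ≟ j
  ... | Relation.Nullary.yes _ = 1#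
  ... | Relation.Nullary.no  _ = 0#

  I : ∀ {n} → Mat n
  I = δ

  _∙ₘ_ : ∀ {n} → Mat n → Mat n → Mat n
  (A ∙ₘ B) i j = Σ[ (λ k → A i k * B k j) ]

  _⟨$⟩_ : ∀ {n} → Mat n → Vec n → Vec n
  (A ⟨$⟩ v) i = Σ[ (λ j → A i j * v j) ]

  record SymplecticSpace (n : ℕ) : Set (c ⊔ ℓ) where
    field
      M          : Mat n
      alt-diag   : ∀ i → M i i ≈ 0#
      alt-skew   : ∀ i j → M i j ≈ (- M j i)
    _•_ : Vec n → Vec n → Carrier
    v • w = Σ[ (λ i → Σ[ (λ j → v i * (M i j * w j)) ]) ]
    field
      nondegenerate : ∀ v → (∀ w → (v • w) ≈ 0#) → v ≈ᵥ 0ᵥ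

  module Symp {n : ℕ} (𝕍 : SymplecticSpace n) where
    open SymplecticSpace 𝕍 public

    IsGL : Mat n → Set (c ⊔ ℓ)
    IsGL A = ∃ λ B → ((A ∙ₘ B) ≈ₘ I) × ((B ∙ₘ A) ≈ₘ I)

    IsGSp : Mat n → Set (c ⊔ ℓ)
    IsGSp A = IsGL A × ∃ λ α → ¬ (α ≈ 0#) ×
              (∀ v w → ((A ⟨$⟩ v) • (A ⟨$⟩ w)) ≈ (α * (v • w)))

    record Subgroup : Set (Level.suc (c ⊔ ℓ)) where
      field
        _∈G     : Mat n → Set (c ⊔ ℓ)
        resp     : ∀ {A B} → A ≈ₘ B → A ∈G → B ∈G
        ⊆GSp     : ∀ {A} → A ∈G → IsGSp A
        id∈      : I ∈G
        ∙∈       : ∀ {A B} → A ∈G → B ∈G → (A ∙ₘ B) ∈G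
        inv∈     : ∀ {A B} → A ∈G → (A ∙ₘ B) ≈ₘ I → B ∈G

    -- symplectic transvection T_v[λ](u) = u + λ (u • v) v, as a matrix:
    -- entry (i,j) is δ_ij + λ v_i (Σ_k M_jk v_k)
    T : Vec n → Carrier → Mat n
    T v λ' i j = δ i j + (λ' * (v i * Σ[ (λ k → M j k * v k) ]))

    𝓛 : Subgroup → Vec n → Set (c ⊔ ℓ)
    𝓛 G v = Nonzero v × ∃ λ λ' → ¬ (λ' ≈ 0#) × (T v λ' ∈G)
      where open Subgroup G

    record Subspace : Set (Level.suc (c ⊔ ℓ)) where
      field
        _∈S    : Vec n → Set (c ⊔ ℓ)
        resp   : ∀ {u v} → u ≈ᵥ v → u ∈S → v ∈S
        0∈     : 0ᵥ ∈S
        +∈     : ∀ {u v} → u ∈S → v ∈S → (u +ᵥ v) ∈S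
        ·∈     : ∀ a {u} → u ∈S → (a ·ᵥ u) ∈S
    open Subspace public

    record OrthDecomposition {m : ℕ} (S : Fin m → Subspace) : Set (c ⊔ ℓ) where
      field
        spans       : ∀ v → ∃ λ (s : Fin m → Vec n) →
                        (∀ i → _∈S (S i) (s i)) × (Σᵥ s ≈ᵥ v)
        independent : ∀ (s : Fin m → Vec n) → (∀ i → _∈S (S i) (s i)) →
                        Σᵥ s ≈ᵥ 0ᵥ → ∀ i → s i ≈ᵥ 0ᵥ
        orthogonal  : ∀ i j → ¬ (i ≡ j) → ∀ u v →
                        _∈S (S i) u → _∈S (S j) v → (u • v) ≈ 0#

    record Subfield : Set (Level.suc (c ⊔ ℓ)) where
      field
        _∈F   : Carrier → Set (c ⊔ ℓ)
        resp  : ∀ {a b} → a ≈ b → a ∈F → b ∈F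
        0∈    : 0# ∈F
        1∈    : 1# ∈F
        +∈    : ∀ {a b} → a ∈F → b ∈F → (a + b) ∈F
        -∈    : ∀ {a} → a ∈F → (- a) ∈F
        *∈    : ∀ {a b} → a ∈F → b ∈F → (a * b) ∈F
        inv∈  : ∀ {a b} → a ∈F → (a * b) ≈ 1# → b ∈F

    module Rational (L : Subfield) (G : Subgroup) where
      open Subfield L using (_∈F)
      open Subgroup G using (_∈G)

      record LSubspace : Set (Level.suc (c ⊔ ℓ)) where
        field
          _∈W   : Vec n → Set (c ⊔ ℓ)
          resp  : ∀ {u v} → u ≈ᵥ v → u ∈W → v ∈W
          0∈    : 0ᵥ ∈W
          +∈    : ∀ {u v} → u ∈W → v ∈W → (u +ᵥ v) ∈W
          ·∈    : ∀ {a u} → a ∈F → u ∈W → (a ·ᵥ u) ∈W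
      open LSubspace public

      LinIndep : (P : Carrier → Set (c ⊔ ℓ)) → ∀ {d} → (Fin d → Vec n) → Set (c ⊔ ℓ)
      LinIndep P {d} b = ∀ (a : Fin d → Carrier) → (∀ k → P (a k)) →
                           Σᵥ (λ k → a k ·ᵥ b k) ≈ᵥ 0ᵥ → ∀ k → a k ≈ 0#

      InSpan : (P : Carrier → Set (c ⊔ ℓ)) → ∀ {d} → (Fin d → Vec n) → Vec n → Set (c ⊔ ℓ)
      InSpan P {d} b v = ∃ λ (a : Fin d → Carrier) → (∀ k → P (a k)) ×
                           (Σᵥ (λ k → a k ·ᵥ b k) ≈ᵥ v)

      AnyK : Carrier → Set (c ⊔ ℓ)
      AnyK _ = Level.Lift (c ⊔ ℓ) Data.Unit.⊤

      -- W_K : v ∈ W_K iff v is a K-linear combination of elements of W_L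
      _∈Kspan_ : Vec n → LSubspace → Set (c ⊔ ℓ)
      v ∈Kspan W = ∃ λ d → ∃ λ (w : Fin d → Vec n) → (∀ k → _∈W W (w k)) ×
                     InSpan AnyK w v

      HasLDim : LSubspace → ℕ → Set (c ⊔ ℓ)
      HasLDim W d = ∃ λ (b : Fin d → Vec n) → (∀ k → _∈W W (b k)) ×
                      LinIndep _∈F b × (∀ v → _∈W W v → InSpan _∈F b v)

      HasKDim : LSubspace → ℕ → Set (c ⊔ ℓ)
      HasKDim W d = ∃ λ (b : Fin d → Vec n) → (∀ k → b k ∈Kspan W) ×
                      LinIndep AnyK b × (∀ v → v ∈Kspan W → InSpan AnyK b v)

      IsLRational : LSubspace → Set (c ⊔ ℓ)
      IsLRational W = (∃ λ d → HasKDim W d × HasLDim W d) ×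
                      (∀ v w → _∈W W v → _∈W W w → (v • w) ∈F)

      IsLGRational : LSubspace → Set (c ⊔ ℓ)
      IsLGRational W =
        IsLRational W ×
        (∀ v λ' → _∈W W v → λ' ∈F → T v λ' ∈G) ×
        (∀ A u μ → A ∈G → Nonzero u → ¬ (μ ≈ 0#) → A ≈ₘ T u μ → u ∈Kspan W →
           ∃ λ v → ∃ λ λ' → _∈W W v × Nonzero v × λ' ∈F × ¬ (λ' ≈ 0#) ×
             (A ≈ₘ T v λ'))

      IsLGRationalisable : Subspace → Set (Level.suc (c ⊔ ℓ))
      IsLGRationalisable S = ∃ λ (W : LSubspace) → IsLGRational W ×
        (∀ v → (v ∈Kspan W → _∈S S v) × (_∈S S v → v ∈Kspan W))

module Submission where

-- For g ∈ G with multiplier α, g T_v[λ] g⁻¹ = T_{gv}[λ/α], so 𝓛(G) is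
-- G-stable (𝓛-stable).  If x ∈ Sᵢ, y ∈ Sⱼ are nonzero and x + y lies in one
-- summand, then i = j by uniqueness of components (same-summand).
-- (a) Apply this to x = g v₁, y = g v₂, which are centres along with g(v₁+v₂).
-- (b) Let b₀, …, b_d be an L-basis of an (L,G)-rational W_L with W_K = S₀.
-- Every b_k and b₀ + b_k is a nonzero vector of W_L, hence a centre, so by (a)
-- all g b_k lie in the summand Sᵢ containing g b₀.  Since g⁻¹Sᵢ is a subspace,
-- it contains the L-span W_L and then the K-span W_K = S₀.

open import Level using (Level)
open import Defs
open import Algebra.Bundles using (CommutativeRing)
open import Data.Nat using (ℕ; zero; suc)
open import Data.Fin using (Fin; zero; suc; _≟_; punchIn)
open import Data.Fin.Properties using (punchInᵢ≢i)
open import Data.Empty using (⊥-elim)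
open import Function using (_∘_)
open import Data.Product using (∃; _×_; _,_; proj₁; proj₂)
open import Relation.Nullary using (¬_; Dec; yes; no)
open import Relation.Binary.PropositionalEquality as ≡ using (_≡_; _≢_)

module Lemmas {c ℓ : Level} (K : Field c ℓ) where
  open FieldTheory K
  open Field K using (commutativeRing; inverse; 1≉0; Carrier; _≈_; _+_; _*_; -_; 0#; 1#)
  open CommutativeRing commutativeRing
    using (semiring; setoid; refl; sym; trans; reflexive; +-cong; +-congˡ; +-identityˡ;
           *-congˡ; *-congʳ; +-identityʳ; *-identityˡ; *-identityʳ; zeroˡ; zeroʳ;
           *-comm; *-assoc; distribˡ; distribʳ; -‿inverseʳ; ring; +-group;
           *-commutativeSemigroup)
  open import Algebra.Properties.Ring ring using (-1*x≈-x)
  open import Algebra.Properties.Group +-group using (x∙y⁻¹≈ε⇒x≈y)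
  open import Algebra.Properties.CommutativeSemigroup *-commutativeSemigroup
    using (x∙yz≈y∙xz; x∙yz≈y∙zx; xy∙z≈xz∙y)
  open import Algebra.Properties.Semiring.Sum semiring
    using (sum; sum-cong-≋; ∑-distrib-+; ∑-comm; sum-remove; sum-replicate-zero;
           *-distribˡ-sum)
  open import Relation.Binary.Reasoning.Setoid setoid

  -- The sum Σ[_] of Defs is the library's 'sum'; this bridge lets us
  -- use the library's summation lemmas.
  Σ≈sum : ∀ {n} (f : Fin n → Carrier) → Σ[ f ] ≈ sum f
  Σ≈sum {zero}  f = refl
  Σ≈sum {suc n} f = +-congˡ (Σ≈sum (λ i → f (suc i)))

  Σ-cong : ∀ {n} {f g : Fin n → Carrier} → (∀ i → f i ≈ g i) → Σ[ f ] ≈ Σ[ g ]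
  Σ-cong {f = f} {g} f≈g = begin
    Σ[ f ]  ≈⟨ Σ≈sum f ⟩
    sum f   ≈⟨ sum-cong-≋ f≈g ⟩
    sum g   ≈⟨ Σ≈sum g ⟨
    Σ[ g ]  ∎

  Σ-+ : ∀ {n} (f g : Fin n → Carrier) → Σ[ (λ i → f i + g i) ] ≈ Σ[ f ] + Σ[ g ]
  Σ-+ f g = begin
    Σ[ (λ i → f i + g i) ]  ≈⟨ Σ≈sum (λ i → f i + g i) ⟩
    sum (λ i → f i + g i)   ≈⟨ ∑-distrib-+ f g ⟩
    sum f + sum g           ≈⟨ +-cong (Σ≈sum f) (Σ≈sum g) ⟨
    Σ[ f ] + Σ[ g ]         ∎

  Σ-*ˡ : ∀ {n} a (f : Fin n → Carrier) → a * Σ[ f ] ≈ Σ[ (λ i → a * f i) ]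
  Σ-*ˡ a f = begin
    a * Σ[ f ]              ≈⟨ *-congˡ (Σ≈sum f) ⟩
    a * sum f               ≈⟨ *-distribˡ-sum a f ⟩
    sum (λ i → a * f i)     ≈⟨ Σ≈sum (λ i → a * f i) ⟨
    Σ[ (λ i → a * f i) ]    ∎

  Σ-swap : ∀ {n m} (f : Fin n → Fin m → Carrier) →
           Σ[ (λ i → Σ[ f i ]) ] ≈ Σ[ (λ j → Σ[ (λ i → f i j) ]) ]
  Σ-swap f = begin
    Σ[ (λ i → Σ[ f i ]) ]                ≈⟨ Σ²≈sum² f ⟩
    sum (λ i → sum (f i))                ≈⟨ ∑-comm f ⟩
    sum (λ j → sum (λ i → f i j))        ≈⟨ Σ²≈sum² (λ j i → f i j) ⟨
    Σ[ (λ j → Σ[ (λ i → f i j) ]) ]      ∎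
    where
    Σ²≈sum² : ∀ {p q} (g : Fin p → Fin q → Carrier) →
              Σ[ (λ i → Σ[ g i ]) ] ≈ sum (λ i → sum (g i))
    Σ²≈sum² g = trans (Σ≈sum (λ i → Σ[ g i ])) (sum-cong-≋ (λ i → Σ≈sum (g i)))

  Σ-zero : ∀ {n} (f : Fin n → Carrier) → (∀ i → f i ≈ 0#) → Σ[ f ] ≈ 0#
  Σ-zero {n} f f≈0 = trans (Σ≈sum f) (trans (sum-cong-≋ f≈0) (sum-replicate-zero n))

  Σ-single : ∀ {n} (j : Fin n) (f : Fin n → Carrier) → (∀ k → k ≢ j → f k ≈ 0#) →
             Σ[ f ] ≈ f j
  Σ-single {suc n} j f others≈0 = begin
    Σ[ f ]                             ≈⟨ Σ≈sum f ⟩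
    sum f                              ≈⟨ sum-remove f ⟩
    f j + sum (λ k → f (punchIn j k))  ≈⟨ +-congˡ rest≈0 ⟩
    f j + 0#                           ≈⟨ +-identityʳ (f j) ⟩
    f j                                ∎
    where
    rest≈0 : sum (λ k → f (punchIn j k)) ≈ 0#
    rest≈0 = trans (sum-cong-≋ (λ k → others≈0 _ (punchInᵢ≢i j k))) (sum-replicate-zero n)

  δ-diag : ∀ {n} (i : Fin n) → δ i i ≈ 1#
  δ-diag i with i ≟ i
  ... | yes _  = refl
  ... | no i≢i = ⊥-elim (i≢i ≡.refl)

  δ-off : ∀ {n} {i j : Fin n} → i ≢ j → δ i j ≈ 0#
  δ-off {i = i} {j} i≢j with i ≟ j
  ... | yes i≡j = ⊥-elim (i≢j i≡j)
  ... | no _    = refl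

  Σ-δ : ∀ {n} (j : Fin n) (f : Fin n → Carrier) → Σ[ (λ k → δ k j * f k) ] ≈ f j
  Σ-δ j f = trans (Σ-single j _ (λ k k≢j → trans (*-congʳ (δ-off k≢j)) (zeroˡ (f k))))
                   (trans (*-congʳ (δ-diag j)) (*-identityˡ (f j)))

  Σ-δ′ : ∀ {n} (j : Fin n) (f : Fin n → Carrier) → Σ[ (λ k → δ j k * f k) ] ≈ f j
  Σ-δ′ j f = trans (Σ-cong (λ k → *-congʳ (reflexive (δ-sym j k)))) (Σ-δ j f)
    where
    δ-sym : ∀ {n} (i k : Fin n) → δ i k ≡ δ k i
    δ-sym i k with i ≟ k | k ≟ i
    ... | yes _   | yes _   = ≡.refl
    ... | no _    | no _    = ≡.refl
    ... | yes i≡k | no k≢i  = ⊥-elim (k≢i (≡.sym i≡k))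
    ... | no i≢k  | yes k≡i = ⊥-elim (i≢k (≡.sym k≡i))

  module Space {n : ℕ} (𝕍 : SymplecticSpace n) where
    open Symp 𝕍

    ⟨$⟩-cong : ∀ (A : Mat n) {u v} → u ≈ᵥ v → (A ⟨$⟩ u) ≈ᵥ (A ⟨$⟩ v)
    ⟨$⟩-cong A u≈v i = Σ-cong (λ j → *-congˡ (u≈v j))

    ⟨$⟩-congₘ : ∀ {A B : Mat n} u → A ≈ₘ B → (A ⟨$⟩ u) ≈ᵥ (B ⟨$⟩ u)
    ⟨$⟩-congₘ u A≈B i = Σ-cong (λ j → *-congʳ (A≈B i j))

    ⟨$⟩-0 : ∀ (A : Mat n) → (A ⟨$⟩ 0ᵥ) ≈ᵥ 0ᵥ
    ⟨$⟩-0 A i = Σ-zero _ (λ j → zeroʳ (A i j))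

    ⟨$⟩-+ : ∀ (A : Mat n) u v → (A ⟨$⟩ (u +ᵥ v)) ≈ᵥ ((A ⟨$⟩ u) +ᵥ (A ⟨$⟩ v))
    ⟨$⟩-+ A u v i = trans (Σ-cong (λ j → distribˡ (A i j) (u j) (v j)))
                          (Σ-+ (λ j → A i j * u j) (λ j → A i j * v j))

    ⟨$⟩-· : ∀ (A : Mat n) a u → (A ⟨$⟩ (a ·ᵥ u)) ≈ᵥ (a ·ᵥ (A ⟨$⟩ u))
    ⟨$⟩-· A a u i = trans (Σ-cong (λ j → x∙yz≈y∙xz (A i j) a (u j)))
                          (sym (Σ-*ˡ a (λ j → A i j * u j)))

    ∙-action : ∀ (A B : Mat n) x → ((A ∙ₘ B) ⟨$⟩ x) ≈ᵥ (A ⟨$⟩ (B ⟨$⟩ x))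
    ∙-action A B x i = begin
      Σ[ (λ j → Σ[ (λ k → A i k * B k j) ] * x j) ]
        ≈⟨ Σ-cong (λ j → trans (*-comm _ (x j)) (Σ-*ˡ (x j) (λ k → A i k * B k j))) ⟩
      Σ[ (λ j → Σ[ (λ k → x j * (A i k * B k j)) ]) ]
        ≈⟨ Σ-swap (λ j k → x j * (A i k * B k j)) ⟩
      Σ[ (λ k → Σ[ (λ j → x j * (A i k * B k j)) ]) ]
        ≈⟨ Σ-cong (λ k → Σ-cong (λ j → x∙yz≈y∙zx (x j) (A i k) (B k j))) ⟩
      Σ[ (λ k → Σ[ (λ j → A i k * (B k j * x j)) ]) ]
        ≈⟨ Σ-cong (λ k → Σ-*ˡ (A i k) (λ j → B k j * x j)) ⟨
      Σ[ (λ k → A i k * Σ[ (λ j → B k j * x j) ]) ] ∎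

    I-action : ∀ x → (I {n} ⟨$⟩ x) ≈ᵥ x
    I-action x i = Σ-δ′ i x

    -- A matrix is determined by its action (apply it to the standard basis).
    matrix-ext : ∀ {A B : Mat n} → (∀ x → (A ⟨$⟩ x) ≈ᵥ (B ⟨$⟩ x)) → A ≈ₘ B
    matrix-ext {A} {B} same i j = begin
      A i j              ≈⟨ column A ⟨
      (A ⟨$⟩ e) i        ≈⟨ same e i ⟩
      (B ⟨$⟩ e) i        ≈⟨ column B ⟩
      B i j              ∎
      where
      e : Vec n
      e k = δ k j
      column : ∀ C → (C ⟨$⟩ e) i ≈ C i j
      column C = trans (Σ-cong (λ k → *-comm (C i k) (δ k j))) (Σ-δ j (C i))

    •-congˡ : ∀ {u u′} w → u ≈ᵥ u′ → (u • w) ≈ (u′ • w)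
    •-congˡ w u≈u′ = Σ-cong {n} (λ i → Σ-cong {n} (λ j → *-congʳ (u≈u′ i)))

    T-action : ∀ v λ′ u → (T v λ′ ⟨$⟩ u) ≈ᵥ (u +ᵥ ((λ′ * (u • v)) ·ᵥ v))
    T-action v λ′ u i = begin
      Σ[ (λ j → (δ i j + λ′ * (v i * C j)) * u j) ]
        ≈⟨ Σ-cong (λ j → distribʳ (u j) (δ i j) _) ⟩
      Σ[ (λ j → δ i j * u j + (λ′ * (v i * C j)) * u j) ]
        ≈⟨ Σ-+ (λ j → δ i j * u j) (λ j → (λ′ * (v i * C j)) * u j) ⟩
      Σ[ (λ j → δ i j * u j) ] + Σ[ (λ j → (λ′ * (v i * C j)) * u j) ]
        ≈⟨ +-cong (Σ-δ′ i u) (Σ-cong (λ j → regroup j)) ⟩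
      u i + Σ[ (λ j → (λ′ * v i) * (u j * C j)) ]
        ≈⟨ +-congˡ (Σ-*ˡ (λ′ * v i) (λ j → u j * C j)) ⟨
      u i + (λ′ * v i) * Σ[ (λ j → u j * C j) ]
        ≈⟨ +-congˡ (*-congˡ (Σ-cong (λ j → Σ-*ˡ (u j) (λ k → M j k * v k)))) ⟩
      u i + (λ′ * v i) * (u • v)
        ≈⟨ +-congˡ (xy∙z≈xz∙y λ′ (v i) (u • v)) ⟩
      u i + (λ′ * (u • v)) * v i ∎
      where
      C : Fin n → Carrier
      C j = Σ[ (λ k → M j k * v k) ]
      regroup : ∀ j → (λ′ * (v i * C j)) * u j ≈ (λ′ * v i) * (u j * C j)
      regroup j = trans (*-congʳ (sym (*-assoc λ′ (v i) (C j))))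
                        (trans (*-assoc (λ′ * v i) (C j) (u j)) (*-congˡ (*-comm (C j) (u j))))

    invertible-nonzero : ∀ {g B : Mat n} → (B ∙ₘ g) ≈ₘ I → ∀ {x} → Nonzero x → Nonzero (g ⟨$⟩ x)
    invertible-nonzero {g} {B} Bg≈I {x} x≉0 gx≈0 = x≉0 λ i → begin
      x i                      ≈⟨ I-action x i ⟨
      (I ⟨$⟩ x) i              ≈⟨ ⟨$⟩-congₘ x Bg≈I i ⟨
      ((B ∙ₘ g) ⟨$⟩ x) i       ≈⟨ ∙-action B g x i ⟩
      (B ⟨$⟩ (g ⟨$⟩ x)) i      ≈⟨ ⟨$⟩-cong B gx≈0 i ⟩
      (B ⟨$⟩ 0ᵥ) i             ≈⟨ ⟨$⟩-0 B i ⟩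
      0#                       ∎

    conjugate-T : ∀ {g B : Mat n} {α β : Carrier} v λ′ → (g ∙ₘ B) ≈ₘ I →
                  (∀ x y → ((g ⟨$⟩ x) • (g ⟨$⟩ y)) ≈ (α * (x • y))) → (β * α) ≈ 1# →
                  (g ∙ₘ (T v λ′ ∙ₘ B)) ≈ₘ T (g ⟨$⟩ v) (λ′ * β)
    conjugate-T {g} {B} {α} {β} v λ′ gB≈I similitude βα≈1 = matrix-ext λ x q →
      let y = B ⟨$⟩ x
          c = λ′ * (y • v)
          gy≈x : (g ⟨$⟩ y) ≈ᵥ x
          gy≈x p = trans (sym (∙-action g B x p)) (trans (⟨$⟩-congₘ x gB≈I p) (I-action x p))
          c≈ : c ≈ (λ′ * β) * (x • (g ⟨$⟩ v))
          c≈ = begin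
            λ′ * (y • v)                           ≈⟨ *-congˡ (*-identityˡ (y • v)) ⟨
            λ′ * (1# * (y • v))                    ≈⟨ *-congˡ (*-congʳ βα≈1) ⟨
            λ′ * ((β * α) * (y • v))               ≈⟨ *-congˡ (*-assoc β α (y • v)) ⟩
            λ′ * (β * (α * (y • v)))               ≈⟨ *-assoc λ′ β (α * (y • v)) ⟨
            (λ′ * β) * (α * (y • v))               ≈⟨ *-congˡ (similitude y v) ⟨
            (λ′ * β) * ((g ⟨$⟩ y) • (g ⟨$⟩ v))     ≈⟨ *-congˡ (•-congˡ (g ⟨$⟩ v) gy≈x) ⟩
            (λ′ * β) * (x • (g ⟨$⟩ v))             ∎
      in begin
      ((g ∙ₘ (T v λ′ ∙ₘ B)) ⟨$⟩ x) q     ≈⟨ ∙-action g (T v λ′ ∙ₘ B) x q ⟩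
      (g ⟨$⟩ ((T v λ′ ∙ₘ B) ⟨$⟩ x)) q    ≈⟨ ⟨$⟩-cong g (∙-action (T v λ′) B x) q ⟩
      (g ⟨$⟩ (T v λ′ ⟨$⟩ y)) q           ≈⟨ ⟨$⟩-cong g (T-action v λ′ y) q ⟩
      (g ⟨$⟩ (y +ᵥ (c ·ᵥ v))) q          ≈⟨ ⟨$⟩-+ g y (c ·ᵥ v) q ⟩
      (g ⟨$⟩ y) q + (g ⟨$⟩ (c ·ᵥ v)) q   ≈⟨ +-cong (gy≈x q) (⟨$⟩-· g c v q) ⟩
      x q + c * (g ⟨$⟩ v) q              ≈⟨ +-congˡ (*-congʳ c≈) ⟩
      x q + ((λ′ * β) * (x • (g ⟨$⟩ v))) * (g ⟨$⟩ v) q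
                                         ≈⟨ T-action (g ⟨$⟩ v) (λ′ * β) x q ⟨
      (T (g ⟨$⟩ v) (λ′ * β) ⟨$⟩ x) q     ∎

    𝓛-stable : ∀ (G : Subgroup) {g} → Subgroup._∈G G g → ∀ {v} → 𝓛 G v → 𝓛 G (g ⟨$⟩ v)
    𝓛-stable G {g} g∈G {v} (v≉0 , λ′ , λ′≉0 , Tv∈G) with Subgroup.⊆GSp G g∈G
    ... | (B , gB≈I , Bg≈I) , α , α≉0 , similitude with inverse α α≉0
    ... | β , αβ≈1 =
      invertible-nonzero Bg≈I v≉0 , λ′ * β , λ′β≉0 ,
      resp-G (conjugate-T v λ′ gB≈I similitude βα≈1) (∙∈ g∈G (∙∈ Tv∈G (inv∈ g∈G gB≈I)))
      where
      open Subgroup G using (∙∈; inv∈) renaming (resp to resp-G)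
      βα≈1 : (β * α) ≈ 1#
      βα≈1 = trans (*-comm β α) αβ≈1
      λ′β≉0 : ¬ ((λ′ * β) ≈ 0#)
      λ′β≉0 λ′β≈0 = λ′≉0 (begin
        λ′                 ≈⟨ *-identityʳ λ′ ⟨
        λ′ * 1#            ≈⟨ *-congˡ βα≈1 ⟨
        λ′ * (β * α)       ≈⟨ *-assoc λ′ β α ⟨
        (λ′ * β) * α       ≈⟨ *-congʳ λ′β≈0 ⟩
        0# * α             ≈⟨ zeroˡ α ⟩
        0#                 ∎)

    combination∈ : ∀ (W : Subspace) {q} (a : Fin q → Carrier) (u : Fin q → Vec n) →
                   (∀ k → _∈S W (u k)) → _∈S W (Σᵥ (λ k → a k ·ᵥ u k))
    combination∈ W {zero}  a u u∈W = 0∈ W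
    combination∈ W {suc q} a u u∈W =
      +∈ W (·∈ W (a zero) (u∈W zero))
           (combination∈ W (λ k → a (suc k)) (λ k → u (suc k)) (λ k → u∈W (suc k)))

    preimage : Mat n → Subspace → Subspace
    preimage g W = record
      { _∈S  = λ v → _∈S W (g ⟨$⟩ v)
      ; resp = λ u≈v → resp W (⟨$⟩-cong g u≈v)
      ; 0∈   = resp W (λ i → sym (⟨$⟩-0 g i)) (0∈ W)
      ; +∈   = λ {u} {v} gu∈W gv∈W → resp W (λ i → sym (⟨$⟩-+ g u v i)) (+∈ W gu∈W gv∈W)
      ; ·∈   = λ a {u} gu∈W → resp W (λ i → sym (⟨$⟩-· g a u i)) (·∈ W a gu∈W)
      }

    module DirectSum {m : ℕ} {S : Fin m → Subspace} (D : OrthDecomposition S) where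
      open OrthDecomposition D using (independent)

      components-unique : ∀ (s t : Fin m → Vec n) → (∀ l → _∈S (S l) (s l)) →
                          (∀ l → _∈S (S l) (t l)) → Σᵥ s ≈ᵥ Σᵥ t → ∀ l → s l ≈ᵥ t l
      components-unique s t s∈S t∈S Σs≈Σt l q =
        difference-zero (independent d (λ l → +∈ (S l) (s∈S l) (·∈ (S l) (- 1#) (t∈S l)))
                                     Σd≈0 l q)
        where
        d : Fin m → Vec n
        d l = s l +ᵥ ((- 1#) ·ᵥ t l)
        minus-self : ∀ x → x + (- 1#) * x ≈ 0#
        minus-self x = trans (+-congˡ (-1*x≈-x x)) (-‿inverseʳ x)
        difference-zero : ∀ {x y} → x + (- 1#) * y ≈ 0# → x ≈ y
        difference-zero {x} {y} x-y≈0 = x∙y⁻¹≈ε⇒x≈y x y (trans (+-congˡ (sym (-1*x≈-x y))) x-y≈0)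
        Σd≈0 : Σᵥ d ≈ᵥ 0ᵥ
        Σd≈0 q = begin
          Σ[ (λ l → s l q + (- 1#) * t l q) ]
            ≈⟨ Σ-+ (λ l → s l q) (λ l → (- 1#) * t l q) ⟩
          Σ[ (λ l → s l q) ] + Σ[ (λ l → (- 1#) * t l q) ]
            ≈⟨ +-cong (Σs≈Σt q) (sym (Σ-*ˡ (- 1#) (λ l → t l q))) ⟩
          Σ[ (λ l → t l q) ] + (- 1#) * Σ[ (λ l → t l q) ]
            ≈⟨ minus-self _ ⟩
          0# ∎

      inject : Fin m → Vec n → Fin m → Vec n
      inject i x l = δ l i ·ᵥ x

      inject-self : ∀ i x → inject i x i ≈ᵥ x
      inject-self i x q = trans (*-congʳ (δ-diag i)) (*-identityˡ (x q))

      inject-other : ∀ {i l} x → l ≢ i → inject i x l ≈ᵥ 0ᵥ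
      inject-other x l≢i q = trans (*-congʳ (δ-off l≢i)) (zeroˡ (x q))

      inject∈ : ∀ {i x} → _∈S (S i) x → ∀ l → _∈S (S l) (inject i x l)
      inject∈ {i} {x} x∈S l = by-slot (l ≟ i)
        where
        by-slot : Dec (l ≡ i) → _∈S (S l) (inject i x l)
        by-slot (yes ≡.refl) = ·∈ (S l) (δ l l) x∈S
        by-slot (no l≢i)     = resp (S l) (λ q → sym (inject-other x l≢i q)) (0∈ (S l))

      Σ-inject : ∀ i x → Σᵥ (inject i x) ≈ᵥ x
      Σ-inject i x q = Σ-δ i (λ _ → x q)

      -- Placing x ∈ Sᵢ, y ∈ Sⱼ and x + y ∈ Sₖ in their slots gives two
      -- decompositions of x + y, which must agree slot by slot.
      slot-equation : ∀ {i j k x y} → _∈S (S i) x → _∈S (S j) y → _∈S (S k) (x +ᵥ y) →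
                      ∀ l → (inject i x l +ᵥ inject j y l) ≈ᵥ inject k (x +ᵥ y) l
      slot-equation {i} {j} {k} {x} {y} x∈S y∈S x+y∈S =
        components-unique _ _ (λ l → +∈ (S l) (inject∈ x∈S l) (inject∈ y∈S l))
                          (inject∈ x+y∈S) Σ-slots
        where
        Σ-slots : Σᵥ (λ l → inject i x l +ᵥ inject j y l) ≈ᵥ Σᵥ (inject k (x +ᵥ y))
        Σ-slots q = begin
          Σ[ (λ l → δ l i * x q + δ l j * y q) ]
            ≈⟨ Σ-+ (λ l → δ l i * x q) (λ l → δ l j * y q) ⟩
          Σ[ (λ l → δ l i * x q) ] + Σ[ (λ l → δ l j * y q) ]
            ≈⟨ +-cong (Σ-inject i x q) (Σ-inject j y q) ⟩
          x q + y q
            ≈⟨ Σ-inject k (x +ᵥ y) q ⟨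
          Σ[ (λ l → δ l k * (x q + y q)) ] ∎

      same-summand : ∀ {i j k x y} → _∈S (S i) x → _∈S (S j) y → _∈S (S k) (x +ᵥ y) →
                     Nonzero x → Nonzero y → i ≡ j
      same-summand {i} {j} {k} {x} {y} x∈S y∈S x+y∈S x≉0 y≉0 with i ≟ j | k ≟ i
      ... | yes i≡j | _          = i≡j
      ... | no i≢j  | yes ≡.refl = ⊥-elim (y≉0 λ q → begin
        y q                                      ≈⟨ +-identityˡ (y q) ⟨
        0# + y q                                 ≈⟨ +-cong (inject-other x (i≢j ∘ ≡.sym) q) (inject-self j y q) ⟨
        (inject i x j +ᵥ inject j y j) q         ≈⟨ slot-equation x∈S y∈S x+y∈S j q ⟩
        inject i (x +ᵥ y) j q                    ≈⟨ inject-other (x +ᵥ y) (i≢j ∘ ≡.sym) q ⟩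
        0#                                       ∎)
      ... | no i≢j  | no k≢i     = ⊥-elim (x≉0 λ q → begin
        x q                                      ≈⟨ +-identityʳ (x q) ⟨
        x q + 0#                                 ≈⟨ +-cong (inject-self i x q) (inject-other y i≢j q) ⟨
        (inject i x i +ᵥ inject j y i) q         ≈⟨ slot-equation x∈S y∈S x+y∈S i q ⟩
        inject k (x +ᵥ y) i q                    ≈⟨ inject-other (x +ᵥ y) (k≢i ∘ ≡.sym) q ⟩
        0#                                       ∎)

    module Centres (G : Subgroup) {h : ℕ} {S : Fin (suc h) → Subspace}
                   (D : OrthDecomposition S)
                   (𝓛⊆⋃S : ∀ v → 𝓛 G v → ∃ λ i → _∈S (S i) v) where
      open Subgroup G using (_∈G)
      open DirectSum D using (same-summand)

      image-summand : ∀ {g} → g ∈G → ∀ v → 𝓛 G v → ∃ λ i → _∈S (S i) (g ⟨$⟩ v)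
      image-summand {g} g∈G v v∈𝓛 = 𝓛⊆⋃S (g ⟨$⟩ v) (𝓛-stable G g∈G v∈𝓛)

      image-same-summand : ∀ {g} → g ∈G → ∀ v₁ v₂ → 𝓛 G v₁ → 𝓛 G v₂ → 𝓛 G (v₁ +ᵥ v₂) →
                           ∀ {i j} → _∈S (S i) (g ⟨$⟩ v₁) → _∈S (S j) (g ⟨$⟩ v₂) → i ≡ j
      image-same-summand {g} g∈G v₁ v₂ v₁∈𝓛 v₂∈𝓛 v₁₂∈𝓛 gv₁∈S gv₂∈S
        with image-summand g∈G (v₁ +ᵥ v₂) v₁₂∈𝓛
      ... | k , gv₁₂∈S =
        same-summand gv₁∈S gv₂∈S (resp (S k) (⟨$⟩-+ g v₁ v₂) gv₁₂∈S)
                     (proj₁ (𝓛-stable G g∈G v₁∈𝓛)) (proj₁ (𝓛-stable G g∈G v₂∈𝓛))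

      move : ∀ {i j v} → i ≡ j → _∈S (S j) v → _∈S (S i) v
      move ≡.refl v∈S = v∈S

      common-summand : ∀ {g} → g ∈G → ∀ v₁ v₂ → 𝓛 G v₁ → 𝓛 G v₂ → 𝓛 G (v₁ +ᵥ v₂) →
                       ∃ λ i → _∈S (S i) (g ⟨$⟩ v₁) × _∈S (S i) (g ⟨$⟩ v₂)
      common-summand g∈G v₁ v₂ v₁∈𝓛 v₂∈𝓛 v₁₂∈𝓛
        with image-summand g∈G v₁ v₁∈𝓛 | image-summand g∈G v₂ v₂∈𝓛
      ... | i , gv₁∈S | j , gv₂∈S =
        i , gv₁∈S , move (image-same-summand g∈G v₁ v₂ v₁∈𝓛 v₂∈𝓛 v₁₂∈𝓛 gv₁∈S gv₂∈S) gv₂∈S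

      joined-in-one-summand : ∀ {d} (u : Fin (suc d) → Vec n) → (∀ k → 𝓛 G (u k)) →
                              (∀ k → 𝓛 G (u zero +ᵥ u (suc k))) → ∀ {g} → g ∈G →
                              ∃ λ i → ∀ k → _∈S (S i) (g ⟨$⟩ u k)
      joined-in-one-summand u u∈𝓛 joined∈𝓛 {g} g∈G
        with image-summand g∈G (u zero) (u∈𝓛 zero)
      ... | i , gu₀∈S = i , all-in
        where
        all-in : ∀ k → _∈S (S i) (g ⟨$⟩ u k)
        all-in zero    = gu₀∈S
        all-in (suc k) with image-summand g∈G (u (suc k)) (u∈𝓛 (suc k))
        ... | j , guₖ∈S =
          move (image-same-summand g∈G (u zero) (u (suc k)) (u∈𝓛 zero) (u∈𝓛 (suc k)) (joined∈𝓛 k)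
                                   gu₀∈S guₖ∈S) guₖ∈S

      module RationalImage (L : Subfield) where
        open Rational L G
        open Subfield L using (_∈F) renaming (0∈ to 0∈L; 1∈ to 1∈L; +∈ to +∈L)

        δ∈L : ∀ {d} (l k : Fin d) → δ l k ∈F
        δ∈L l k with l ≟ k
        ... | yes _ = 1∈L
        ... | no _  = 0∈L

        independent-nonzero : ∀ {d} (b : Fin d → Vec n) → LinIndep _∈F b →
                              ∀ a → (∀ l → a l ∈F) → ∀ k → ¬ (a k ≈ 0#) →
                              ∀ {v} → Σᵥ (λ l → a l ·ᵥ b l) ≈ᵥ v → Nonzero v
        independent-nonzero b b-indep a a∈L k aₖ≉0 Σ≈v v≈0 =
          aₖ≉0 (b-indep a a∈L (λ q → trans (Σ≈v q) (v≈0 q)) k)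

        rational-centre : ∀ W {v} → (∀ v λ′ → _∈W W v → λ′ ∈F → T v λ′ ∈G) →
                          _∈W W v → Nonzero v → 𝓛 G v
        rational-centre W T∈G v∈W v≉0 = v≉0 , 1# , 1≉0 , T∈G _ 1# v∈W 1∈L

        basis-nonzero : ∀ {d} (b : Fin d → Vec n) → LinIndep _∈F b → ∀ k → Nonzero (b k)
        basis-nonzero b b-indep k =
          independent-nonzero b b-indep (λ l → δ l k) (λ l → δ∈L l k) k
                              (λ δkk≈0 → 1≉0 (trans (sym (δ-diag k)) δkk≈0))
                              (λ q → Σ-δ k (λ l → b l q))

        basis-sum-nonzero : ∀ {d} (b : Fin (suc d) → Vec n) → LinIndep _∈F b →
                            ∀ k → Nonzero (b zero +ᵥ b (suc k))
        basis-sum-nonzero {d} b b-indep k =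
          independent-nonzero b b-indep a (λ l → +∈L (δ∈L l zero) (δ∈L l (suc k)))
                              zero a₀≉0 Σ≈b₀+bₖ
          where
          a : Fin (suc d) → Carrier
          a l = δ l zero + δ l (suc k)
          a₀≉0 : ¬ (a zero ≈ 0#)
          a₀≉0 a₀≈0 = 1≉0 (begin
            1#           ≈⟨ +-identityʳ 1# ⟨
            1# + 0#      ≈⟨ +-cong (δ-diag {suc d} zero) (δ-off {i = zero} {suc k} (λ ())) ⟨
            a zero       ≈⟨ a₀≈0 ⟩
            0#           ∎)
          Σ≈b₀+bₖ : Σᵥ (λ l → a l ·ᵥ b l) ≈ᵥ (b zero +ᵥ b (suc k))
          Σ≈b₀+bₖ q = trans (Σ-cong (λ l → distribʳ (b l q) (δ l zero) (δ l (suc k))))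
                          (trans (Σ-+ (λ l → δ l zero * b l q) (λ l → δ l (suc k) * b l q))
                                 (+-cong (Σ-δ zero (λ l → b l q)) (Σ-δ (suc k) (λ l → b l q))))

        basis-image : ∀ W {d} (b : Fin d → Vec n) → (∀ v λ′ → _∈W W v → λ′ ∈F → T v λ′ ∈G) →
                      (∀ k → _∈W W (b k)) → LinIndep _∈F b → ∀ {g} → g ∈G →
                      ∃ λ i → ∀ k → _∈S (S i) (g ⟨$⟩ b k)
        basis-image W {zero}  b T∈G b∈W b-indep g∈G = zero , λ ()
        basis-image W {suc d} b T∈G b∈W b-indep g∈G =
          joined-in-one-summand b
            (λ k → rational-centre W T∈G (b∈W k) (basis-nonzero b b-indep k))
            (λ k → rational-centre W T∈G (LSubspace.+∈ W (b∈W zero) (b∈W (suc k)))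
                                         (basis-sum-nonzero b b-indep k))
            g∈G

        rationalisable-image : ∀ {S₀} → IsLGRationalisable S₀ → ∀ {g} → g ∈G →
                               ∃ λ i → ∀ v → _∈S S₀ v → _∈S (S i) (g ⟨$⟩ v)
        rationalisable-image (W , (((_ , _ , b , b∈W , b-indep , b-spans) , _) , T∈G , _) , S₀≡W_K)
                             {g} g∈G with basis-image W b T∈G b∈W b-indep g∈G
        ... | i , gb∈Sᵢ = i , λ v v∈S₀ → W_K⊆ (proj₂ (S₀≡W_K v) v∈S₀)
          where
          -- g⁻¹Sᵢ contains the basis, hence W_L, hence its K-span.
          target : Subspace
          target = preimage g (S i)
          W_L⊆ : ∀ {w} → _∈W W w → _∈S target w
          W_L⊆ w∈W with b-spans _ w∈W
          ... | c , _ , Σ≈w = resp target Σ≈w (combination∈ target c b gb∈Sᵢ)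
          W_K⊆ : ∀ {v} → v ∈Kspan W → _∈S target v
          W_K⊆ (_ , w , w∈W , a , _ , Σ≈v) =
            resp target Σ≈v (combination∈ target a w (λ l → W_L⊆ (w∈W l)))

lemma8p1 : ∀ {c ℓ} (K : Field c ℓ) →
    let open FieldTheory K in
    IsFinite → CharAtLeast5 →
    ∀ {n} (𝕍 : SymplecticSpace n) →
    let open Symp 𝕍 in
    (G : Subgroup) (h : ℕ) (S : Fin (suc h) → Subspace) →
    OrthDecomposition S →
    (∀ v → 𝓛 G v → ∃ λ i → _∈S (S i) v) →
    (∀ v₁ v₂ → 𝓛 G v₁ → 𝓛 G v₂ → _∈S (S zero) v₁ → _∈S (S zero) v₂ →
      𝓛 G (v₁ +ᵥ v₂) →
      ∀ g → Subgroup._∈G G g →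
      ∃ λ i → _∈S (S i) (g ⟨$⟩ v₁) × _∈S (S i) (g ⟨$⟩ v₂))
    ×
    (∀ (L : Subfield) → Rational.IsLGRationalisable L G (S zero) →
      ∀ g → Subgroup._∈G G g →
      ∃ λ i → ∀ v → _∈S (S zero) v → _∈S (S i) (g ⟨$⟩ v))
lemma8p1 K _ _ {n} 𝕍 G h S D 𝓛⊆⋃S =
  (λ v₁ v₂ v₁∈𝓛 v₂∈𝓛 _ _ v₁₂∈𝓛 g g∈G → common-summand g∈G v₁ v₂ v₁∈𝓛 v₂∈𝓛 v₁₂∈𝓛) ,
  (λ L S₀-rationalisable g g∈G → RationalImage.rationalisable-image L {S zero} S₀-rationalisable g∈G)
  where
  open Lemmas.Space.Centres K {n} 𝕍 G {h} {S} D 𝓛⊆⋃S
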